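{- Let $(\bar y,\bar C_{k,j},\bar C_j)$ be a feasible solution of the LP (LP3) defined in the context, and let $\alpha>1$ and $\delta>0$. For $\ell\in\mathcal L$ let $S(\ell)=\{T_{k,j}\in\mathcal T:(1+\delta)^{\ell-1}\le\alpha\bar C_{k,j}<(1+\delta)^\ell\}$. Suppose that we ignore any possible precedences among the tasks of $S(\ell)$. Then the tasks of $S(\ell)$ can be fractionally scheduled on the processors $\mathcal P$ with makespan at most $\frac{\alpha}{\alpha-1}(1+\delta)^\ell$. Explicitly, there exist $x_{i,k,j}\ge0$ such that: - $\sum_{i\in\mathcal P}x_{i,k,j}=1$ for each $T_{k,j}\in S(\ell)$; - $x_{i,k,j}=0$ whenever $p_{i,k,j}>(1+\delta)^\ell$; - $\sum_{T_{k,j}\in S(\ell)}p_{i,k,j}x_{i,k,j}\le\frac{\alpha}{\alpha-1}(1+\delta)^\ell$ for every $i\in\mathcal P$.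
   Context: **Problem data.** We are given: - a set of processors $\mathcal P$; - a set of tasks $\mathcal T$, where each task $T_{k,j}$ belongs to a job $j$ with weight $w_j$; - processing times $p_{i,k,j}$ of task $T_{k,j}$ on processor $i$; - precedence relations $T_{k',j}\prec T_{k,j}$ among tasks of the same job. **LP.** Let $t_{\max}=\sum_{T_{k,j}\in\mathcal T}\max_{i\in\mathcal P}p_{i,k,j}$, let $L$ be the smallest integer with $(1+\delta)^{L-1}\ge t_{\max}$, and write $\mathcal L=\{1,\dots,L\}$. The LP (LP3) has variables $y_{i,k,j,\ell}\ge0$ ($i\in\mathcal P$, $T_{k,j}\in\mathcal T$, $\ell\in\mathcal L$), $C_{k,j}$ and $C_j$. It minimizes $\sum_jw_jC_j$ subject to: - $\sum_{i,\ell}y_{i,k,j,\ell}\ge1$ for every task; - $C_j\ge C_{k,j}$; - $C_{k,j}\ge C_{k',j}+\sum_ip_{i,k,j}\sum_\ell y_{i,k,j,\ell}$ whenever $T_{k',j}\prec T_{k,j}$; - $\sum_i\sum_\ell(1+\delta)^{\ell-1}y_{i,k,j,\ell}\le C_{k,j}$; - $\sum_{T_{k,j}\in\mathcal T}p_{i,k,j}\sum_{t\le\ell}y_{i,k,j,t}\le(1+\delta)^\ell$ for all $i,\ell$; - $y_{i,k,j,\ell}=0$ whenever $p_{i,k,j}>(1+\delta)^\ell$.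
   Formalization: The processing times, the job weights, the constants α and δ, and the LP solution $(\bar y,\bar C_{k,j},\bar C_j)$ are all rational. -}

module Defs where

open import Data.Nat as ℕ using (ℕ; zero; suc)
import Data.Fin
open import Data.Fin using (Fin; toℕ)
open import Data.Bool using (Bool; if_then_else_; _∧_)
open import Data.Product using (_×_)
open import Relation.Nullary using (yes; no)
open import Relation.Nullary.Decidable using (⌊_⌋)
open import Relation.Binary.PropositionalEquality using (_≡_)
open import Data.Rational
  using (ℚ; 0ℚ; 1ℚ; _+_; _*_; _-_; _÷_; _≤_; _<_; _⊔_; ≢-nonZero)
open import Data.Rational.Properties using (_≤?_; _<?_; _≟_)

Σ : (n : ℕ) → (Fin n → ℚ) → ℚ
Σ zero    f = 0ℚ
Σ (suc n) f = f Data.Fin.zero + Σ n (λ i → f (Data.Fin.suc i))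


-- Finite maximum  max_{i : Fin n} f i  (0 for n = 0; only used on
-- nonnegative data).
Max : (n : ℕ) → (Fin n → ℚ) → ℚ
Max zero    f = 0ℚ
Max (suc n) f = f Data.Fin.zero ⊔ Max n (λ i → f (Data.Fin.suc i))

pow : ℚ → ℕ → ℚ
pow q zero    = 1ℚ
pow q (suc e) = q * pow q e

-- α / (α - 1) (set to 0 in the degenerate case α = 1, which is excluded
-- by the hypothesis α > 1 of the theorem).
ratio : ℚ → ℚ
ratio α with (α - 1ℚ) ≟ 0ℚ
... | yes _ = 0ℚ
... | no ne = _÷_ α (α - 1ℚ) {{≢-nonZero ne}}

-- Scheduling instance.
--   m processors  : Fin m
--   n tasks T_{k,j}: Fin n, task t belongs to job (job t) : Fin J
--   p i t         : processing time of task t on processor i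
--   prec t' t     : T_{k',j} ≺ T_{k,j}
record Instance : Set₁ where
  field
    m J n  : ℕ
    job    : Fin n → Fin J
    w      : Fin J → ℚ
    p      : Fin m → Fin n → ℚ
    p-nonneg : ∀ i t → 0ℚ ≤ p i t
    prec   : Fin n → Fin n → Set
    prec-sameJob : ∀ t' t → prec t' t → job t' ≡ job t

module _ (I : Instance) where
  open Instance I

  tmax : ℚ
  tmax = Σ n (λ t → Max m (λ i → p i t))

  -- L is the smallest (positive) integer with (1+δ)^(L-1) ≥ t_max.
  -- ℒ = {1,…,L} is represented by Fin L, index l standing for ℓ = toℕ l + 1,
  -- so (1+δ)^(ℓ-1) = pow (1+δ) (toℕ l) and (1+δ)^ℓ = pow (1+δ) (suc (toℕ l)).
  IsL : ℚ → ℕ → Set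
  IsL δ L = (1 ℕ.≤ L) × (tmax ≤ pow (1ℚ + δ) (L ℕ.∸ 1))
          × (∀ L' → 1 ℕ.≤ L' → L' ℕ.< L → pow (1ℚ + δ) (L' ℕ.∸ 1) < tmax)

  record Feasible (δ : ℚ) (L : ℕ)
                  (y : Fin m → Fin n → Fin L → ℚ)
                  (Ct : Fin n → ℚ) (Cj : Fin J → ℚ) : Set where
    field
      y-nonneg : ∀ i t l → 0ℚ ≤ y i t l
      assign   : ∀ t → 1ℚ ≤ Σ m (λ i → Σ L (λ l → y i t l))
      jobC     : ∀ t → Ct t ≤ Cj (job t)
      precC    : ∀ t' t → prec t' t →
                 Ct t' + Σ m (λ i → p i t * Σ L (λ l → y i t l)) ≤ Ct t
      startC   : ∀ t →
                 Σ m (λ i → Σ L (λ l → pow (1ℚ + δ) (toℕ l) * y i t l)) ≤ Ct t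
      load     : ∀ i (l : Fin L) →
                 Σ n (λ t → p i t *
                   Σ L (λ l' → if ⌊ toℕ l' ℕ.≤? toℕ l ⌋ then y i t l' else 0ℚ))
                   ≤ pow (1ℚ + δ) (suc (toℕ l))
      tooLong  : ∀ i t l → pow (1ℚ + δ) (suc (toℕ l)) < p i t → y i t l ≡ 0ℚ

  InS : ℚ → ℚ → (Fin n → ℚ) → {L : ℕ} → Fin L → Fin n → Set
  InS δ α Ct l t = (pow (1ℚ + δ) (toℕ l) ≤ α * Ct t)
                 × (α * Ct t < pow (1ℚ + δ) (suc (toℕ l)))

  inS? : ℚ → ℚ → (Fin n → ℚ) → {L : ℕ} → Fin L → Fin n → Bool
  inS? δ α Ct l t = ⌊ pow (1ℚ + δ) (toℕ l) ≤? α * Ct t ⌋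
                    ∧ ⌊ α * Ct t <? pow (1ℚ + δ) (suc (toℕ l)) ⌋

module Submission where

-- Fix a feasible LP solution and a level ℓ, and write
-- P = (1+δ)^ℓ.  Split the LP mass of a task t into its early part
-- E_t = Σ_i Σ_{ℓ' ≤ ℓ} y_{i,t,ℓ'} and its late part R_t (levels ℓ' > ℓ).
-- Every late unit has weight (1+δ)^(ℓ'-1) ≥ P in the start-time
-- constraint, so P·R_t ≤ C_t; for t ∈ S(ℓ) we have α·C_t < P, hence
-- α·R_t < 1.  Together with E_t + R_t ≥ 1 this forces E_t ≥ (α-1)/α.
-- Normalising the early part, x_{i,t} = y_{i,t,≤ℓ} / E_t, gives a
-- fractional assignment using only processors with p_{i,t} ≤ P, and the
-- load at processor i grows by at most a factor 1/E_t ≤ α/(α-1) over the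
-- LP load constraint at level ℓ, which is at most P.

open import Defs
open import Data.Nat using (ℕ; suc)
open import Data.Fin using (Fin; toℕ)
open import Data.Bool using (if_then_else_)
open import Data.Product using (_×_; Σ-syntax)
open import Relation.Binary.PropositionalEquality using (_≡_)
open import Data.Rational using (ℚ; 0ℚ; 1ℚ; _+_; _*_; _≤_; _<_)
open Instance

import Data.Nat as ℕ
import Data.Nat.Properties as ℕ
open import Data.Bool using (Bool; true; false; T)
open import Data.Empty using (⊥-elim)
open import Data.Fin using (zero; suc)
open import Data.Product using (_,_)
open import Data.Rational using (-_; _-_; 1/_; Positive; positive; nonNegative; ≢-nonZero)
open import Data.Rational.Properties
open import Data.Rational.Solver using (module +-*-Solver)
open import Relation.Binary.PropositionalEquality
  using (refl; sym; trans; cong; cong₂; subst; _≢_; module ≡-Reasoning)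
open import Relation.Nullary using (yes; no)
open import Relation.Nullary.Decidable using (⌊_⌋; toWitness)

open +-*-Solver using (solve; _:+_; _:*_; _:-_; con; _:=_)

0<1 : 0ℚ < 1ℚ
0<1 = toWitness {a? = 0ℚ <? 1ℚ} _

*-monoˡ-≤ : ∀ {r p q} → 0ℚ ≤ r → p ≤ q → r * p ≤ r * q
*-monoˡ-≤ {r} 0≤r = *-monoˡ-≤-nonNeg r {{nonNegative 0≤r}}

*-nonneg : ∀ {p q} → 0ℚ ≤ p → 0ℚ ≤ q → 0ℚ ≤ p * q
*-nonneg {p} {q} 0≤p 0≤q = subst (_≤ p * q) (*-zeroʳ p) (*-monoˡ-≤ 0≤p 0≤q)

if-≤ : ∀ b {u v} → (T b → u ≤ v) → 0ℚ ≤ v → (if b then u else 0ℚ) ≤ v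
if-≤ true  u≤v _   = u≤v _
if-≤ false _   0≤v = 0≤v

if-nonneg : ∀ b {v} → 0ℚ ≤ v → 0ℚ ≤ (if b then v else 0ℚ)
if-nonneg true  0≤v = 0≤v
if-nonneg false _   = ≤-refl

if-split : ∀ b v → v ≡ (if b then v else 0ℚ) + (if b then 0ℚ else v)
if-split true  v = sym (+-identityʳ v)
if-split false v = sym (+-identityˡ v)

Σ-cong : ∀ k {f g : Fin k → ℚ} → (∀ i → f i ≡ g i) → Σ k f ≡ Σ k g
Σ-cong ℕ.zero    f≡g = refl
Σ-cong (ℕ.suc k) f≡g = cong₂ _+_ (f≡g zero) (Σ-cong k (λ i → f≡g (suc i)))

Σ-mono : ∀ k {f g : Fin k → ℚ} → (∀ i → f i ≤ g i) → Σ k f ≤ Σ k g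
Σ-mono ℕ.zero    f≤g = ≤-refl
Σ-mono (ℕ.suc k) f≤g = +-mono-≤ (f≤g zero) (Σ-mono k (λ i → f≤g (suc i)))

Σ-zero : ∀ k → Σ k (λ _ → 0ℚ) ≡ 0ℚ
Σ-zero ℕ.zero    = refl
Σ-zero (ℕ.suc k) = trans (+-identityˡ _) (Σ-zero k)

Σ-nonneg : ∀ k {f : Fin k → ℚ} → (∀ i → 0ℚ ≤ f i) → 0ℚ ≤ Σ k f
Σ-nonneg k {f} 0≤f = subst (_≤ Σ k f) (Σ-zero k) (Σ-mono k 0≤f)

Σ-+ : ∀ k (f g : Fin k → ℚ) → Σ k (λ i → f i + g i) ≡ Σ k f + Σ k g
Σ-+ ℕ.zero    f g = sym (+-identityˡ 0ℚ)
Σ-+ (ℕ.suc k) f g = begin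
  (f zero + g zero) + Σ k (λ i → f (suc i) + g (suc i))
    ≡⟨ cong (f zero + g zero +_) (Σ-+ k (λ i → f (suc i)) (λ i → g (suc i))) ⟩
  (f zero + g zero) + (Σ k (λ i → f (suc i)) + Σ k (λ i → g (suc i)))
    ≡⟨ interchange (f zero) (g zero) _ _ ⟩
  (f zero + Σ k (λ i → f (suc i))) + (g zero + Σ k (λ i → g (suc i)))  ∎
  where
  open ≡-Reasoning
  interchange : ∀ a b c d → (a + b) + (c + d) ≡ (a + c) + (b + d)
  interchange = solve 4 (λ a b c d → (a :+ b) :+ (c :+ d) := (a :+ c) :+ (b :+ d)) refl

Σ-*ˡ : ∀ k c (f : Fin k → ℚ) → Σ k (λ i → c * f i) ≡ c * Σ k f
Σ-*ˡ ℕ.zero    c f = sym (*-zeroʳ c)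
Σ-*ˡ (ℕ.suc k) c f =
  trans (cong (c * f zero +_) (Σ-*ˡ k c (λ i → f (suc i))))
        (sym (*-distribˡ-+ c (f zero) (Σ k (λ i → f (suc i)))))

-- A total reciprocal on ℚ (with recip 0 = 0), used to normalise masses.

recip : ℚ → ℚ
recip q with q ≟ 0ℚ
... | yes _ = 0ℚ
... | no q≢0 = (1/ q) {{≢-nonZero q≢0}}

recip-inverseʳ : ∀ q → q ≢ 0ℚ → q * recip q ≡ 1ℚ
recip-inverseʳ q q≢0 with q ≟ 0ℚ
... | yes q≡0 = ⊥-elim (q≢0 q≡0)
... | no q≢0' = *-inverseʳ q {{≢-nonZero q≢0'}}

recip-nonneg : ∀ q → 0ℚ ≤ q → 0ℚ ≤ recip q
recip-nonneg q 0≤q with q ≟ 0ℚ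
... | yes _ = ≤-refl
... | no q≢0 = <⇒≤ (positive⁻¹ _ {{1/pos⇒pos q {{q>0}}}})
  where
  q>0 : Positive q
  q>0 = nonNeg∧nonZero⇒pos q {{nonNegative 0≤q}} {{≢-nonZero q≢0}}

factor-≢0 : ∀ {r M} → 1ℚ ≤ r * M → M ≢ 0ℚ
factor-≢0 {r} 1≤rM M≡0 =
  <-irrefl refl (<-≤-trans 0<1 (subst (1ℚ ≤_) (trans (cong (r *_) M≡0) (*-zeroʳ r)) 1≤rM))

recip-≤ : ∀ {r M} → 0ℚ ≤ M → 1ℚ ≤ r * M → recip M ≤ r
recip-≤ {r} {M} 0≤M 1≤rM = begin
  recip M                ≡⟨ sym (*-identityʳ (recip M)) ⟩
  recip M * 1ℚ           ≤⟨ *-monoˡ-≤ (recip-nonneg M 0≤M) 1≤rM ⟩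
  recip M * (r * M)      ≡⟨ solve 3 (λ u r M → u :* (r :* M) := r :* (M :* u)) refl (recip M) r M ⟩
  r * (M * recip M)      ≡⟨ cong (r *_) (recip-inverseʳ M (factor-≢0 {r} 1≤rM)) ⟩
  r * 1ℚ                 ≡⟨ *-identityʳ r ⟩
  r                      ∎
  where open ≤-Reasoning

pow-≥1 : ∀ {q} → 1ℚ ≤ q → ∀ e → 1ℚ ≤ pow q e
pow-≥1 1≤q ℕ.zero = ≤-refl
pow-≥1 {q} 1≤q (ℕ.suc e) = begin
  1ℚ            ≤⟨ 1≤q ⟩
  q             ≡⟨ sym (*-identityʳ q) ⟩
  q * 1ℚ        ≤⟨ *-monoˡ-≤ (≤-trans (<⇒≤ 0<1) 1≤q) (pow-≥1 1≤q e) ⟩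
  q * pow q e   ∎
  where open ≤-Reasoning

pow-mono : ∀ {q} → 1ℚ ≤ q → ∀ {e e'} → e ℕ.≤ e' → pow q e ≤ pow q e'
pow-mono 1≤q {e' = e'} ℕ.z≤n        = pow-≥1 1≤q e'
pow-mono 1≤q           (ℕ.s≤s e≤e') = *-monoˡ-≤ (≤-trans (<⇒≤ 0<1) 1≤q) (pow-mono 1≤q e≤e')

pow-nonneg : ∀ {q} → 1ℚ ≤ q → ∀ e → 0ℚ ≤ pow q e
pow-nonneg 1≤q e = ≤-trans (<⇒≤ 0<1) (pow-≥1 1≤q e)

α-1>0 : ∀ {α} → 1ℚ < α → 0ℚ < α - 1ℚ
α-1>0 {α} 1<α = subst (_< α - 1ℚ) (+-inverseʳ 1ℚ) (+-monoˡ-< (- 1ℚ) 1<α)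

ratio-spec : ∀ {α} → 1ℚ < α → (α - 1ℚ) * ratio α ≡ α
ratio-spec {α} 1<α with (α - 1ℚ) ≟ 0ℚ
... | yes α-1≡0 = ⊥-elim (<-irrefl (sym α-1≡0) (α-1>0 1<α))
... | no α-1≢0 = begin
  d * (α * e)   ≡⟨ solve 3 (λ d α e → d :* (α :* e) := α :* (d :* e)) refl d α e ⟩
  α * (d * e)   ≡⟨ cong (α *_) (*-inverseʳ d {{≢-nonZero α-1≢0}}) ⟩
  α * 1ℚ        ≡⟨ *-identityʳ α ⟩
  α             ∎
  where
  open ≡-Reasoning
  d e : ℚ
  d = α - 1ℚ
  e = (1/ d) {{≢-nonZero α-1≢0}}

ratio-nonneg : ∀ {α} → 1ℚ < α → 0ℚ ≤ ratio α
ratio-nonneg {α} 1<α = *-cancelˡ-≤-pos (α - 1ℚ) {{positive (α-1>0 1<α)}} (begin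
  (α - 1ℚ) * 0ℚ      ≡⟨ *-zeroʳ (α - 1ℚ) ⟩
  0ℚ                 ≤⟨ <⇒≤ (<-trans 0<1 1<α) ⟩
  α                  ≡⟨ sym (ratio-spec 1<α) ⟩
  (α - 1ℚ) * ratio α ∎)
  where open ≤-Reasoning

mass-bound : ∀ {α E R} → 1ℚ < α → 1ℚ ≤ E + R → α * R < 1ℚ → 1ℚ ≤ ratio α * E
mass-bound {α} {E} {R} 1<α 1≤E+R αR<1 =
  *-cancelˡ-≤-pos (α - 1ℚ) {{positive (α-1>0 1<α)}} (begin
    (α - 1ℚ) * 1ℚ              ≡⟨ *-identityʳ (α - 1ℚ) ⟩
    α - 1ℚ                     ≤⟨ +-monoˡ-≤ (- 1ℚ) α≤αE+1 ⟩
    (α * E + 1ℚ) - 1ℚ          ≡⟨ solve 2 (λ α E → (α :* E :+ con 1ℚ) :- con 1ℚ := α :* E) refl α E ⟩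
    α * E                      ≡⟨ cong (_* E) (sym (ratio-spec 1<α)) ⟩
    ((α - 1ℚ) * ratio α) * E   ≡⟨ *-assoc (α - 1ℚ) (ratio α) E ⟩
    (α - 1ℚ) * (ratio α * E)   ∎)
  where
  open ≤-Reasoning
  α≤αE+1 : α ≤ α * E + 1ℚ
  α≤αE+1 = begin
    α                ≡⟨ sym (*-identityʳ α) ⟩
    α * 1ℚ           ≤⟨ *-monoˡ-≤ (<⇒≤ (<-trans 0<1 1<α)) 1≤E+R ⟩
    α * (E + R)      ≡⟨ *-distribˡ-+ α E R ⟩
    α * E + α * R    ≤⟨ +-monoʳ-≤ (α * E) (<⇒≤ αR<1) ⟩
    α * E + 1ℚ       ∎

module LevelSchedule
    (I : Instance) (δ α : ℚ) (L : ℕ)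
    (y : Fin (m I) → Fin (n I) → Fin L → ℚ) (Ct : Fin (n I) → ℚ) (Cj : Fin (J I) → ℚ)
    (δ>0 : 0ℚ < δ) (1<α : 1ℚ < α) (F : Feasible I δ L y Ct Cj) (l : Fin L) where

  open Feasible F

  1≤1+δ : 1ℚ ≤ 1ℚ + δ
  1≤1+δ = subst (_≤ 1ℚ + δ) (+-identityʳ 1ℚ) (+-monoʳ-≤ 1ℚ (<⇒≤ δ>0))

  P : ℚ
  P = pow (1ℚ + δ) (suc (toℕ l))

  early : Fin L → Bool
  early l' = ⌊ toℕ l' ℕ.≤? toℕ l ⌋

  earlyMass lateMass : Fin (m I) → Fin (n I) → ℚ
  earlyMass i t = Σ L (λ l' → if early l' then y i t l' else 0ℚ)
  lateMass  i t = Σ L (λ l' → if early l' then 0ℚ else y i t l')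

  E R : Fin (n I) → ℚ
  E t = Σ (m I) (λ i → earlyMass i t)
  R t = Σ (m I) (λ i → lateMass i t)

  earlyMass-nonneg : ∀ i t → 0ℚ ≤ earlyMass i t
  earlyMass-nonneg i t = Σ-nonneg L (λ l' → if-nonneg (early l') (y-nonneg i t l'))

  E-nonneg : ∀ t → 0ℚ ≤ E t
  E-nonneg t = Σ-nonneg (m I) (λ i → earlyMass-nonneg i t)

  mass-split : ∀ t → Σ (m I) (λ i → Σ L (λ l' → y i t l')) ≡ E t + R t
  mass-split t = trans
    (Σ-cong (m I) (λ i → trans (Σ-cong L (λ l' → if-split (early l') (y i t l')))
                               (Σ-+ L _ _)))
    (Σ-+ (m I) _ _)

  late-weight : ∀ i t l' → P * (if early l' then 0ℚ else y i t l')
                           ≤ pow (1ℚ + δ) (toℕ l') * y i t l'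
  late-weight i t l' with toℕ l' ℕ.≤? toℕ l
  ... | yes _ = subst (_≤ pow (1ℚ + δ) (toℕ l') * y i t l') (sym (*-zeroʳ P)) (*-nonneg (pow-nonneg 1≤1+δ (toℕ l')) (y-nonneg i t l'))
  ... | no  ℓ'≰ℓ = *-monoʳ-≤-nonNeg (y i t l') {{nonNegative (y-nonneg i t l')}}
                     (pow-mono 1≤1+δ (ℕ.≰⇒> ℓ'≰ℓ))

  late-cost : ∀ t → P * R t ≤ Ct t
  late-cost t = begin
    P * R t
      ≡⟨ sym (Σ-*ˡ (m I) P (λ i → lateMass i t)) ⟩
    Σ (m I) (λ i → P * lateMass i t)
      ≡⟨ Σ-cong (m I) (λ i → sym (Σ-*ˡ L P _)) ⟩
    Σ (m I) (λ i → Σ L (λ l' → P * (if early l' then 0ℚ else y i t l')))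
      ≤⟨ Σ-mono (m I) (λ i → Σ-mono L (late-weight i t)) ⟩
    Σ (m I) (λ i → Σ L (λ l' → pow (1ℚ + δ) (toℕ l') * y i t l'))
      ≤⟨ startC t ⟩
    Ct t ∎
    where open ≤-Reasoning

  late-small : ∀ t → InS I δ α Ct l t → α * R t < 1ℚ
  late-small t (_ , αC<P) = *-cancelˡ-<-nonNeg P {{nonNegative (pow-nonneg 1≤1+δ (suc (toℕ l)))}} (begin-strict
    P * (α * R t)   ≡⟨ solve 3 (λ P α R → P :* (α :* R) := α :* (P :* R)) refl P α (R t) ⟩
    α * (P * R t)   ≤⟨ *-monoˡ-≤ (<⇒≤ (<-trans 0<1 1<α)) (late-cost t) ⟩
    α * Ct t        <⟨ αC<P ⟩
    P               ≡⟨ sym (*-identityʳ P) ⟩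
    P * 1ℚ          ∎)
    where open ≤-Reasoning

  early-large : ∀ t → InS I δ α Ct l t → 1ℚ ≤ ratio α * E t
  early-large t t∈S = mass-bound 1<α (subst (1ℚ ≤_) (mass-split t) (assign t)) (late-small t t∈S)

  x : Fin (m I) → Fin (n I) → ℚ
  x i t = recip (E t) * earlyMass i t

  x-nonneg : ∀ i t → 0ℚ ≤ x i t
  x-nonneg i t = *-nonneg (recip-nonneg (E t) (E-nonneg t)) (earlyMass-nonneg i t)

  x-sum : ∀ t → InS I δ α Ct l t → Σ (m I) (λ i → x i t) ≡ 1ℚ
  x-sum t t∈S = begin
    Σ (m I) (λ i → recip (E t) * earlyMass i t)   ≡⟨ Σ-*ˡ (m I) (recip (E t)) _ ⟩
    recip (E t) * E t                            ≡⟨ *-comm (recip (E t)) (E t) ⟩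
    E t * recip (E t)                            ≡⟨ recip-inverseʳ (E t) (factor-≢0 {ratio α} (early-large t t∈S)) ⟩
    1ℚ                                           ∎
    where open ≡-Reasoning

  early-too-long : ∀ i t → P < p I i t → ∀ l' → (if early l' then y i t l' else 0ℚ) ≡ 0ℚ
  early-too-long i t P<p l' with toℕ l' ℕ.≤? toℕ l
  ... | yes ℓ'≤ℓ = tooLong i t l' (≤-<-trans (pow-mono 1≤1+δ (ℕ.s≤s ℓ'≤ℓ)) P<p)
  ... | no  _    = refl

  x-too-long : ∀ i t → P < p I i t → x i t ≡ 0ℚ
  x-too-long i t P<p =
    trans (cong (recip (E t) *_) (trans (Σ-cong L (early-too-long i t P<p)) (Σ-zero L)))
          (*-zeroʳ (recip (E t)))

  inS?⇒InS : ∀ t → T (inS? I δ α Ct l t) → InS I δ α Ct l t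
  inS?⇒InS t h with pow (1ℚ + δ) (toℕ l) ≤? α * Ct t | α * Ct t <? P
  ... | yes lo | yes hi = lo , hi
  ... | yes _  | no  _  = ⊥-elim h
  ... | no  _  | _      = ⊥-elim h

  load-term : ∀ i t → (if inS? I δ α Ct l t then p I i t * x i t else 0ℚ)
                      ≤ ratio α * (p I i t * earlyMass i t)
  load-term i t = if-≤ (inS? I δ α Ct l t) bound
    (*-nonneg (ratio-nonneg 1<α) pY-nonneg)
    where
    pY-nonneg : 0ℚ ≤ p I i t * earlyMass i t
    pY-nonneg = *-nonneg (p-nonneg I i t) (earlyMass-nonneg i t)
    bound : T (inS? I δ α Ct l t) → p I i t * x i t ≤ ratio α * (p I i t * earlyMass i t)
    bound h = begin
      p I i t * (recip (E t) * earlyMass i t)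
        ≡⟨ solve 3 (λ p u Y → p :* (u :* Y) := u :* (p :* Y)) refl (p I i t) (recip (E t)) (earlyMass i t) ⟩
      recip (E t) * (p I i t * earlyMass i t)
        ≤⟨ *-monoʳ-≤-nonNeg (p I i t * earlyMass i t) {{nonNegative pY-nonneg}}
             (recip-≤ {ratio α} (E-nonneg t) (early-large t (inS?⇒InS t h))) ⟩
      ratio α * (p I i t * earlyMass i t) ∎
      where open ≤-Reasoning

  x-load : ∀ i → Σ (n I) (λ t → if inS? I δ α Ct l t then p I i t * x i t else 0ℚ) ≤ ratio α * P
  x-load i = begin
    Σ (n I) (λ t → if inS? I δ α Ct l t then p I i t * x i t else 0ℚ)
      ≤⟨ Σ-mono (n I) (load-term i) ⟩
    Σ (n I) (λ t → ratio α * (p I i t * earlyMass i t))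
      ≡⟨ Σ-*ˡ (n I) (ratio α) (λ t → p I i t * earlyMass i t) ⟩
    ratio α * Σ (n I) (λ t → p I i t * earlyMass i t)
      ≤⟨ *-monoˡ-≤ (ratio-nonneg 1<α) (load i l) ⟩
    ratio α * P ∎
    where open ≤-Reasoning

mainTheorem3 : (I : Instance) (δ α : ℚ) (L : ℕ)
    (y : Fin (m I) → Fin (n I) → Fin L → ℚ) (Ct : Fin (n I) → ℚ) (Cj : Fin (J I) → ℚ) →
    0ℚ < δ → 1ℚ < α → IsL I δ L → Feasible I δ L y Ct Cj →
    (l : Fin L) →
    Σ[ x ∈ (Fin (m I) → Fin (n I) → ℚ) ]
      ((∀ i t → InS I δ α Ct l t → 0ℚ ≤ x i t)
      × (∀ t → InS I δ α Ct l t → Defs.Σ (m I) (λ i → x i t) ≡ 1ℚ)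
      × (∀ i t → InS I δ α Ct l t → pow (1ℚ + δ) (suc (toℕ l)) < p I i t → x i t ≡ 0ℚ)
      × (∀ i → Defs.Σ (n I) (λ t → if inS? I δ α Ct l t then p I i t * x i t else 0ℚ)
               ≤ ratio α * pow (1ℚ + δ) (suc (toℕ l))))
mainTheorem3 I δ α L y Ct Cj δ>0 1<α _ F l =
  x , (λ i t _ → x-nonneg i t) , x-sum , (λ i t _ → x-too-long i t) , x-load
  where open LevelSchedule I δ α L y Ct Cj δ>0 1<α F l
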